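{- Let $q=p^r$, where $p$ is a prime and $r\geq 1$, and let $E\subset\mathbb{F}_q^2$. Suppose $E$ is neither $\mathbb{F}_q^2\setminus\{(0,0)\}$ nor all of $\mathbb{F}_q^2$, and suppose that at least $2$ distinct lines through the origin intersect $E\setminus\{(0,0)\}$. Let $R_E=\{\theta\in\mathrm{SL}_2(\mathbb{F}_q):\theta(E)=E\}$. Then $|R_E|\leq p^{r-1}|E|$.
   Context: $\mathrm{SL}_2(\mathbb{F}_q)$ acts on $\mathbb{F}_q^2$ by matrix multiplication on column vectors; $\theta(E)=\{\theta x: x\in E\}$. -}

module Defs where

open import Level using (0ℓ)
open import Data.Nat using (ℕ)
open import Data.Product using (_×_; _,_; ∃; Σ)
open import Relation.Binary.PropositionalEquality using (_≡_; _≢_)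
open import Relation.Nullary using (¬_)
open import Algebra.Core using (Op₁; Op₂)
open import Algebra.Structures using (IsCommutativeRing)
open import Function.Bundles using (_⇔_)

record Field : Set₁ where
  infixl 7 _*_
  infixl 6 _+_ _-_
  field
    Carrier : Set
    _+_ _*_ : Op₂ Carrier
    -_ : Op₁ Carrier
    0# 1# : Carrier
    isCommutativeRing : IsCommutativeRing _≡_ _+_ _*_ -_ 0# 1#
    0≢1 : 0# ≢ 1#
    inverse : ∀ x → x ≢ 0# → ∃ λ y → x * y ≡ 1#

  _-_ : Op₂ Carrier
  x - y = x + (- y)

module _ (F : Field) where
  open Field F

  Point : Set
  Point = Carrier × Carrier

  origin : Point
  origin = (0# , 0#)

  scale : Carrier → Point → Point
  scale t (x , y) = (t * x , t * y)

  OnLineThrough : Point → Point → Set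
  OnLineThrough u v = ∃ λ t → v ≡ scale t u

  -- 2×2 matrices ((a b) (c d)) stored as (a , b , c , d)
  Mat : Set
  Mat = Carrier × Carrier × Carrier × Carrier

  det : Mat → Carrier
  det (a , b , c , d) = a * d - b * c

  InSL₂ : Mat → Set
  InSL₂ θ = det θ ≡ 1#

  act : Mat → Point → Point
  act (a , b , c , d) (x , y) = (a * x + b * y , c * x + d * y)

  Preserves : Mat → (Point → Set) → Set
  Preserves θ E = ∀ w → (E w ⇔ (∃ λ v → E v × act θ v ≡ w))

  InR : (Point → Set) → Mat → Set
  InR E θ = InSL₂ θ × Preserves θ E

module Submission where

-- Fix u ∈ E ∖ {0} and w with ω u w = 1, where ω is the area form.  Two
-- elements θ₀, θ of R_E with θ₀ u = θ u differ by the transvection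
-- x ↦ x + t ω(u,x) u, which then preserves E, and θ is determined by t; so
-- |R_E| ≤ |E| · |T_u|, where T_u is the additive subgroup of those t whose
-- transvection preserves E.  By Lagrange |T_u| divides q = p^r, hence
-- |T_u| ≤ p^(r-1) unless T_u = F.  If T_u = T_v = F for independent u, v ∈ E,
-- then E is invariant under both transvection groups, which generate SL₂,
-- transitive on F² ∖ {0}; so E ⊇ F² ∖ {0}, which the hypotheses exclude.

open import Defs
open import Algebra.Bundles using (CommutativeRing)
open import Algebra.Core using (Op₁; Op₂)
open import Algebra.Structures using (IsGroup)
open import Data.List using (List; []; _∷_; length; filter; map; allFin)
open import Data.List.Membership.Propositional using (_∈_)
open import Data.List.Membership.Propositional.Properties using (∈-filter⁺; ∈-filter⁻; ∈-map⁺; ∈-allFin)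
open import Data.List.Relation.Unary.All as All using (All; []; _∷_)
import Data.List.Relation.Unary.All.Properties as All
open import Data.List.Relation.Unary.Any using (here; there)
open import Data.List.Relation.Unary.Unique.Propositional using (Unique)
import Data.List.Relation.Unary.Unique.Propositional.Properties as Unique
open import Data.Empty using (⊥-elim)
open import Data.Nat as ℕ using (ℕ; zero; suc; _≤_; _<_; _^_; z≤n; s≤s)
import Data.Nat.Properties as ℕ
open import Data.Nat.Primality using (Prime)
open import Data.Fin using (Fin)
open import Data.Product using (_×_; _,_; ∃; proj₁; proj₂)
open import Data.Sum using (_⊎_; inj₁; inj₂; [_,_]′)
open import Function.Bundles using (_↔_; _⇔_; Equivalence; mk⇔)
open import Level using (0ℓ)
open import Relation.Binary.Definitions using (DecidableEquality)
open import Relation.Binary.PropositionalEquality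
open import Relation.Nullary using (¬_; Dec; yes; no; contradiction)
open import Relation.Unary using (Pred; Decidable)
open import Relation.Unary.Properties using (∁?)

module Counting where

  open import Data.List.Properties using (length-removeAt′)
  open import Data.List.Relation.Unary.Any using (_─_)
  open import Data.List.Relation.Unary.AllPairs using (_∷_)
  open import Data.Nat using (_+_; _*_)
  open ℕ.≤-Reasoning

  module _ {A : Set} where

    length-filter+filter-∁ : {P : Pred A 0ℓ} (P? : Decidable P) → ∀ xs →
                             length (filter P? xs) + length (filter (∁? P?) xs) ≡ length xs
    length-filter+filter-∁ P? []       = refl
    length-filter+filter-∁ P? (x ∷ xs) with P? x
    ... | yes _ = cong suc (length-filter+filter-∁ P? xs)
    ... | no  _ = trans (ℕ.+-suc _ _) (cong suc (length-filter+filter-∁ P? xs))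

    ∈-─ : ∀ {x y : A} {xs} → y ∈ xs → (x∈xs : x ∈ xs) → y ≢ x → y ∈ (xs ─ x∈xs)
    ∈-─ (here refl) (here refl) y≢x = contradiction refl y≢x
    ∈-─ (here y≡z)  (there _)   _   = here y≡z
    ∈-─ (there y∈)  (here refl) _   = y∈
    ∈-─ (there y∈)  (there x∈)  y≢x = there (∈-─ y∈ x∈ y≢x)

  module _ {A B : Set} (f : A → B) where

    injection⇒length≤ : ∀ {xs ys} → Unique xs → (∀ {x} → x ∈ xs → f x ∈ ys) →
                        (∀ {x y} → x ∈ xs → y ∈ xs → f x ≡ f y → x ≡ y) →
                        length xs ≤ length ys
    injection⇒length≤ {[]}     _                 _    _   = z≤n
    injection⇒length≤ {x ∷ xs} {ys} (x∉xs ∷ xs!) into inj =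
      subst (suc (length xs) ≤_) (sym (length-removeAt′ ys _))
        (s≤s (injection⇒length≤ xs! into′ (λ x∈ y∈ → inj (there x∈) (there y∈))))
      where
      fx∈ys : f x ∈ ys
      fx∈ys = into (here refl)
      into′ : ∀ {y} → y ∈ xs → f y ∈ (ys ─ fx∈ys)
      into′ y∈ = ∈-─ (into (there y∈)) fx∈ys
        (λ fy≡fx → All.lookup x∉xs y∈ (inj (here refl) (there y∈) (sym fy≡fx)))

    fibre-bound⇒length≤ : DecidableEquality B → {Q : Pred A 0ℓ} (K : ℕ) →
      (∀ b {zs} → Unique zs → All Q zs → All (λ z → f z ≡ b) zs → length zs ≤ K) →
      ∀ ys {xs} → Unique xs → All Q xs → All (λ x → f x ∈ ys) xs → length xs ≤ length ys * K
    fibre-bound⇒length≤ _≟_ K fibre [] {[]}    _ _ _          = z≤n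
    fibre-bound⇒length≤ _≟_ K fibre [] {_ ∷ _} _ _ (() ∷ _)
    fibre-bound⇒length≤ _≟_ K fibre (y ∷ ys) {xs} xs! Qxs into = begin
      length xs                                                     ≡⟨ sym (length-filter+filter-∁ over-y? xs) ⟩
      length (filter over-y? xs) + length (filter (∁? over-y?) xs)  ≤⟨ ℕ.+-mono-≤ fibre-y rest ⟩
      K + length ys * K                                             ∎
      where
      over-y? : Decidable (λ x → f x ≡ y)
      over-y? x = f x ≟ y
      fibre-y : length (filter over-y? xs) ≤ K
      fibre-y = fibre y (Unique.filter⁺ over-y? xs!) (All.filter⁺ over-y? Qxs) (All.all-filter over-y? xs)
      into-ys : All (λ x → f x ∈ ys) (filter (∁? over-y?) xs)
      into-ys = All.tabulate λ x∈ → drop-y (∈-filter⁻ (∁? over-y?) {xs = xs} x∈)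
        where
        drop-y : ∀ {x} → x ∈ xs × f x ≢ y → f x ∈ ys
        drop-y (x∈xs , fx≢y) with All.lookup into x∈xs
        ... | here fx≡y = contradiction fx≡y fx≢y
        ... | there fx∈ = fx∈
      rest : length (filter (∁? over-y?) xs) ≤ length ys * K
      rest = fibre-bound⇒length≤ _≟_ K fibre ys (Unique.filter⁺ (∁? over-y?) xs!)
               (All.filter⁺ (∁? over-y?) Qxs) into-ys

open Counting

module PrimePowers where

  open import Data.Nat using (_*_)
  open import Data.Nat.Divisibility
  open import Data.Nat.Primality using (euclidsLemma; prime⇒nonZero)

  proper∣p^[1+r]⇒∣p^r : ∀ {p m} r → Prime p → m ∣ p ^ suc r → m ≢ p ^ suc r → m ∣ p ^ r
  proper∣p^[1+r]⇒∣p^r {p} {m} r p-prime (divides k p^[1+r]≡k*m) m≢p^[1+r]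
    with euclidsLemma k m p-prime (divides (p ^ r) (trans (sym p^[1+r]≡k*m) (ℕ.*-comm p (p ^ r))))
  ... | inj₁ (divides k′ refl) = *-cancelˡ-∣ p (divides k′ (trans p^[1+r]≡k*m (ℕ.*-assoc k′ p m)))
    where instance _ = prime⇒nonZero p-prime
  ... | inj₂ (divides m′ refl) = m′*p∣p^n r m′∣p^r m≢p^[1+r]
    where
    instance _ = prime⇒nonZero p-prime
    m′∣p^r : m′ ∣ p ^ r
    m′∣p^r = *-cancelˡ-∣ p (divides k (trans p^[1+r]≡k*m (cong (k *_) (ℕ.*-comm m′ p))))
    m′*p∣p^n : ∀ n → m′ ∣ p ^ n → m′ * p ≢ p ^ suc n → m′ * p ∣ p ^ n
    m′*p∣p^n zero    m′∣1         m≢p        =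
      contradiction (trans (cong (_* p) (∣1⇒≡1 m′∣1)) (ℕ.*-identityˡ p))
                    (λ m≡p → m≢p (trans m≡p (sym (ℕ.*-identityʳ p))))
    m′*p∣p^n (suc n) m′∣p^[1+n] m≢p^[2+n] = subst (m′ * p ∣_) (ℕ.*-comm (p ^ n) p)
      (*-monoˡ-∣ p (proper∣p^[1+r]⇒∣p^r n p-prime m′∣p^[1+n]
        (λ m′≡p^[1+n] → m≢p^[2+n] (trans (cong (_* p) m′≡p^[1+n]) (ℕ.*-comm (p ^ suc n) p)))))

open PrimePowers

module Lagrange
  {A : Set} {_∙_ : Op₂ A} {ε : A} {_⁻¹ : Op₁ A} (isGroup : IsGroup _≡_ _∙_ ε _⁻¹)
  (elements : List A) (elements! : Unique elements) (∈-elements : ∀ x → x ∈ elements)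
  {H : Pred A 0ℓ} (H? : Decidable H)
  (H-ε : H ε) (H-∙ : ∀ {x y} → H x → H y → H (x ∙ y)) (H-⁻¹ : ∀ {x} → H x → H (x ⁻¹))
  where

  open import Algebra.Bundles using (Group)
  open import Data.List.Properties using (filter-notAll)
  open import Data.Nat.Divisibility using (_∣_; _∣0; ∣m∣n⇒∣m+n; ∣-reflexive)
  open import Data.Nat.Induction using (<-wellFounded)
  open import Induction.WellFounded using (Acc; acc)

  private
    group : Group 0ℓ 0ℓ
    group = record { isGroup = isGroup }
  open Group group using (_\\_; assoc; inverseˡ)
  open import Algebra.Properties.Group group using (∙-cancelˡ; \\-leftDividesʳ; //-rightDividesʳ)

  |H| : ℕ
  |H| = length (filter H? elements)

  RightInvariant : List A → Set
  RightInvariant xs = ∀ {x h} → x ∈ xs → H h → x ∙ h ∈ xs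

  InCoset? : ∀ a → Decidable (λ x → H (a \\ x))
  InCoset? a x = H? (a \\ x)

  coset-size : ∀ {a xs} → a ∈ xs → Unique xs → RightInvariant xs → length (filter (InCoset? a) xs) ≡ |H|
  coset-size {a} {xs} a∈xs xs! invariant = ℕ.≤-antisym
    (injection⇒length≤ (a \\_) (Unique.filter⁺ (InCoset? a) xs!)
       (λ x∈ → ∈-filter⁺ H? (∈-elements _) (proj₂ (∈-filter⁻ (InCoset? a) {xs = xs} x∈)))
       (λ _ _ → ∙-cancelˡ (a ⁻¹) _ _))
    (injection⇒length≤ (a ∙_) (Unique.filter⁺ H? elements!)
       (λ h∈ → let Hh = proj₂ (∈-filter⁻ H? {xs = elements} h∈) in
               ∈-filter⁺ (InCoset? a) (invariant a∈xs Hh) (subst H (sym (\\-leftDividesʳ a _)) Hh))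
       (λ _ _ → ∙-cancelˡ a _ _))

  |H|∣length : ∀ xs → Acc _<_ (length xs) → Unique xs → RightInvariant xs → |H| ∣ length xs
  |H|∣length []       _        _   _         = |H| ∣0
  |H|∣length (a ∷ xs) (acc rs) xs! invariant =
    subst (|H| ∣_) (length-filter+filter-∁ (InCoset? a) (a ∷ xs))
      (∣m∣n⇒∣m+n (∣-reflexive (sym (coset-size (here refl) xs! invariant)))
                 (|H|∣length rest (rs shorter) (Unique.filter⁺ (∁? (InCoset? a)) xs!) rest-invariant))
    where
    rest : List A
    rest = filter (∁? (InCoset? a)) (a ∷ xs)
    shorter : length rest < length (a ∷ xs)
    shorter = filter-notAll (∁? (InCoset? a)) (a ∷ xs)
      (here (λ a∉aH → a∉aH (subst H (sym (inverseˡ a)) H-ε)))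
    rest-invariant : RightInvariant rest
    rest-invariant {x} {h} x∈ Hh with ∈-filter⁻ (∁? (InCoset? a)) {xs = a ∷ xs} x∈
    ... | x∈xs , x∉aH = ∈-filter⁺ (∁? (InCoset? a)) (invariant x∈xs Hh)
      (λ xh∈aH → x∉aH (subst H (//-rightDividesʳ h (a \\ x))
                         (H-∙ (subst H (sym (assoc (a ⁻¹) x h)) xh∈aH) (H-⁻¹ Hh))))

  lagrange : |H| ∣ length elements
  lagrange = |H|∣length elements (<-wellFounded _) elements! (λ _ _ → ∈-elements _)

-- The ring solver needs coefficients with a decidable equality that map
-- homomorphically into the field; ℤ does for every commutative ring.
module IntegerCoefficients (F : Field) where

  open import Data.Integer as ℤ using (ℤ; -[1+_]; _⊖_)
  import Data.Integer.Properties as ℤ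
  open import Data.Maybe using (Maybe; just; nothing)
  open import Data.Sign as Sign using (Sign)
  open import Algebra.Solver.Ring.AlmostCommutativeRing using (fromCommutativeRing; _-Raw-AlmostCommutative⟶_)

  open Field F

  commutativeRing : CommutativeRing 0ℓ 0ℓ
  commutativeRing = record { isCommutativeRing = isCommutativeRing }

  open CommutativeRing commutativeRing
    using (ring; semiring; +-monoid; +-group; +-abelianGroup; +-comm; +-identityˡ; +-identityʳ;
           -‿inverseʳ; *-identityˡ; zeroʳ)
  open import Algebra.Properties.Ring ring using (-1*x≈-x; -0#≈0#)
  open import Algebra.Properties.AbelianGroup +-abelianGroup using (⁻¹-∙-comm)
  open import Algebra.Properties.Group +-group using (⁻¹-involutive)
  open import Algebra.Properties.Monoid.Mult.TCOptimised +-monoid using (×-homo-+) renaming (_×_ to _×′_)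
  open import Algebra.Properties.Semiring.Mult.TCOptimised semiring using (×1-homo-*)
  open import Algebra.Properties.CommutativeSemigroup
    (CommutativeRing.+-commutativeSemigroup commutativeRing) using () renaming (interchange to +-interchange)
  open import Algebra.Properties.CommutativeSemigroup
    (CommutativeRing.*-commutativeSemigroup commutativeRing) using () renaming (interchange to *-interchange)
  open ≡-Reasoning

  -- With the optimised multiple _×′_, 0 ×′ 1# and 1 ×′ 1# reduce to 0# and 1#,
  -- so the solver's constants 0 and 1 denote 0# and 1# definitionally.
  ⟦_⟧ : ℤ → Carrier
  ⟦ ℤ.+ n ⟧    = n ×′ 1#
  ⟦ -[1+ n ] ⟧ = - (suc n ×′ 1#)

  ⊖-homo : ∀ m n → ⟦ m ⊖ n ⟧ ≡ m ×′ 1# - n ×′ 1#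
  ⊖-homo zero    zero    = sym (-‿inverseʳ 0#)
  ⊖-homo zero    (suc n) = sym (+-identityˡ _)
  ⊖-homo (suc m) zero    = sym (trans (cong ((suc m ×′ 1#) +_) -0#≈0#) (+-identityʳ _))
  ⊖-homo (suc m) (suc n) = begin
    ⟦ suc m ⊖ suc n ⟧                 ≡⟨ cong ⟦_⟧ (ℤ.[1+m]⊖[1+n]≡m⊖n m n) ⟩
    ⟦ m ⊖ n ⟧                         ≡⟨ ⊖-homo m n ⟩
    m ×′ 1# - n ×′ 1#                   ≡⟨ sym (+-identityˡ _) ⟩
    0# + (m ×′ 1# - n ×′ 1#)            ≡⟨ cong (_+ (m ×′ 1# - n ×′ 1#)) (sym (-‿inverseʳ 1#)) ⟩
    (1# - 1#) + (m ×′ 1# - n ×′ 1#)     ≡⟨ +-interchange 1# (- 1#) (m ×′ 1#) (- (n ×′ 1#)) ⟩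
    (1# + m ×′ 1#) + (- 1# - n ×′ 1#)   ≡⟨ cong ((1# + m ×′ 1#) +_) (⁻¹-∙-comm 1# (n ×′ 1#)) ⟩
    (1# + m ×′ 1#) - (1# + n ×′ 1#)     ≡⟨ sym (cong₂ _-_ (×-homo-+ 1# 1 m) (×-homo-+ 1# 1 n)) ⟩
    suc m ×′ 1# - suc n ×′ 1#           ∎

  +-homo : ∀ i j → ⟦ i ℤ.+ j ⟧ ≡ ⟦ i ⟧ + ⟦ j ⟧
  +-homo (ℤ.+ m)  (ℤ.+ n)  = ×-homo-+ 1# m n
  +-homo (ℤ.+ m)  -[1+ n ] = ⊖-homo m (suc n)
  +-homo -[1+ m ] (ℤ.+ n)  = trans (⊖-homo n (suc m)) (+-comm _ _)
  +-homo -[1+ m ] -[1+ n ] = begin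
    - (suc (suc (m ℕ.+ n)) ×′ 1#)      ≡⟨ cong (λ k → - (k ×′ 1#)) (sym (ℕ.+-suc (suc m) n)) ⟩
    - ((suc m ℕ.+ suc n) ×′ 1#)        ≡⟨ cong -_ (×-homo-+ 1# (suc m) (suc n)) ⟩
    - (suc m ×′ 1# + suc n ×′ 1#)       ≡⟨ sym (⁻¹-∙-comm _ _) ⟩
    - (suc m ×′ 1#) + - (suc n ×′ 1#)   ∎

  -‿homo : ∀ i → ⟦ ℤ.- i ⟧ ≡ - ⟦ i ⟧
  -‿homo (ℤ.+ zero)    = sym -0#≈0#
  -‿homo (ℤ.+ (suc n)) = refl
  -‿homo -[1+ n ]      = sym (⁻¹-involutive _)

  ⟦_⟧ₛ : Sign → Carrier
  ⟦ Sign.+ ⟧ₛ = 1#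
  ⟦ Sign.- ⟧ₛ = - 1#

  sign-homo : ∀ s t → ⟦ s Sign.* t ⟧ₛ ≡ ⟦ s ⟧ₛ * ⟦ t ⟧ₛ
  sign-homo Sign.+ t      = sym (*-identityˡ _)
  sign-homo Sign.- Sign.+ = sym (-1*x≈-x _)
  sign-homo Sign.- Sign.- = sym (trans (-1*x≈-x (- 1#)) (⁻¹-involutive 1#))

  ◃-homo : ∀ s n → ⟦ s ℤ.◃ n ⟧ ≡ ⟦ s ⟧ₛ * (n ×′ 1#)
  ◃-homo s      zero    = sym (zeroʳ _)
  ◃-homo Sign.+ (suc n) = sym (*-identityˡ _)
  ◃-homo Sign.- (suc n) = sym (-1*x≈-x _)

  ⟦⟧≡sign*abs : ∀ i → ⟦ i ⟧ ≡ ⟦ ℤ.sign i ⟧ₛ * (ℤ.∣ i ∣ ×′ 1#)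
  ⟦⟧≡sign*abs (ℤ.+ n)  = sym (*-identityˡ _)
  ⟦⟧≡sign*abs -[1+ n ] = sym (-1*x≈-x _)

  *-homo : ∀ i j → ⟦ i ℤ.* j ⟧ ≡ ⟦ i ⟧ * ⟦ j ⟧
  *-homo i j = begin
    ⟦ (ℤ.sign i Sign.* ℤ.sign j) ℤ.◃ (ℤ.∣ i ∣ ℕ.* ℤ.∣ j ∣) ⟧
      ≡⟨ ◃-homo (ℤ.sign i Sign.* ℤ.sign j) (ℤ.∣ i ∣ ℕ.* ℤ.∣ j ∣) ⟩
    ⟦ ℤ.sign i Sign.* ℤ.sign j ⟧ₛ * ((ℤ.∣ i ∣ ℕ.* ℤ.∣ j ∣) ×′ 1#)
      ≡⟨ cong₂ _*_ (sign-homo (ℤ.sign i) (ℤ.sign j)) (×1-homo-* ℤ.∣ i ∣ ℤ.∣ j ∣) ⟩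
    (⟦ ℤ.sign i ⟧ₛ * ⟦ ℤ.sign j ⟧ₛ) * ((ℤ.∣ i ∣ ×′ 1#) * (ℤ.∣ j ∣ ×′ 1#))
      ≡⟨ *-interchange _ _ _ _ ⟩
    (⟦ ℤ.sign i ⟧ₛ * (ℤ.∣ i ∣ ×′ 1#)) * (⟦ ℤ.sign j ⟧ₛ * (ℤ.∣ j ∣ ×′ 1#))
      ≡⟨ sym (cong₂ _*_ (⟦⟧≡sign*abs i) (⟦⟧≡sign*abs j)) ⟩
    ⟦ i ⟧ * ⟦ j ⟧ ∎

  ℤ⟶F : ℤ.+-*-rawRing -Raw-AlmostCommutative⟶ fromCommutativeRing commutativeRing
  ℤ⟶F = record
    { ⟦_⟧ = ⟦_⟧ ; +-homo = +-homo ; *-homo = *-homo ; -‿homo = -‿homo ; 0-homo = refl ; 1-homo = refl }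

  ⟦⟧-≟ : ∀ i j → Maybe (⟦ i ⟧ ≡ ⟦ j ⟧)
  ⟦⟧-≟ i j with i ℤ.≟ j
  ... | yes refl = just refl
  ... | no _     = nothing

  open import Algebra.Solver.Ring ℤ.+-*-rawRing (fromCommutativeRing commutativeRing) ℤ⟶F ⟦⟧-≟
    public using (solve; Polynomial; _:+_; _:*_; _:-_; :-_; _:=_)
  open import Algebra.Solver.Ring ℤ.+-*-rawRing (fromCommutativeRing commutativeRing) ℤ⟶F ⟦⟧-≟
    using (con)

  :0 :1 : ∀ {n} → Polynomial n
  :0 = con (ℤ.+ 0)
  :1 = con (ℤ.+ 1)

module Plane (F : Field) where

  open Field F
  open IntegerCoefficients F using (commutativeRing; solve; _:+_; _:*_; _:-_; :-_; _:=_; :0; :1)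
  open CommutativeRing commutativeRing using (*-identityˡ; *-identityʳ; -‿inverseʳ)
  open ≡-Reasoning

  infixl 6 _⊕_
  infixr 7 _·_

  _⊕_ : Point F → Point F → Point F
  (x₁ , x₂) ⊕ (y₁ , y₂) = (x₁ + y₁ , x₂ + y₂)

  _·_ : Carrier → Point F → Point F
  _·_ = scale F

  ω : Point F → Point F → Carrier
  ω (x₁ , x₂) (y₁ , y₂) = x₁ * y₂ - x₂ * y₁

  transvection : Point F → Carrier → Point F → Point F
  transvection u t x = x ⊕ (t * ω u x) · u

  act-⊕ : ∀ θ x y → act F θ (x ⊕ y) ≡ act F θ x ⊕ act F θ y
  act-⊕ (a , b , c , d) (x₁ , x₂) (y₁ , y₂) = cong₂ _,_ (lemma a b) (lemma c d)
    where
    lemma : ∀ a b → a * (x₁ + y₁) + b * (x₂ + y₂) ≡ (a * x₁ + b * x₂) + (a * y₁ + b * y₂)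
    lemma a b = solve 6 (λ a b x₁ x₂ y₁ y₂ →
      a :* (x₁ :+ y₁) :+ b :* (x₂ :+ y₂) := (a :* x₁ :+ b :* x₂) :+ (a :* y₁ :+ b :* y₂))
      refl a b x₁ x₂ y₁ y₂

  act-· : ∀ θ t x → act F θ (t · x) ≡ t · act F θ x
  act-· (a , b , c , d) t (x₁ , x₂) = cong₂ _,_ (lemma a b) (lemma c d)
    where
    lemma : ∀ a b → a * (t * x₁) + b * (t * x₂) ≡ t * (a * x₁ + b * x₂)
    lemma a b = solve 5 (λ a b t x₁ x₂ →
      a :* (t :* x₁) :+ b :* (t :* x₂) := t :* (a :* x₁ :+ b :* x₂)) refl a b t x₁ x₂

  ω-act : ∀ θ x y → ω (act F θ x) (act F θ y) ≡ det F θ * ω x y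
  ω-act (a , b , c , d) (x₁ , x₂) (y₁ , y₂) =
    solve 8 (λ a b c d x₁ x₂ y₁ y₂ →
      (a :* x₁ :+ b :* x₂) :* (c :* y₁ :+ d :* y₂) :- (c :* x₁ :+ d :* x₂) :* (a :* y₁ :+ b :* y₂)
        := (a :* d :- b :* c) :* (x₁ :* y₂ :- x₂ :* y₁)) refl a b c d x₁ x₂ y₁ y₂

  cramer : ∀ u w x → ω u w · x ≡ ω x w · u ⊕ ω u x · w
  cramer (u₁ , u₂) (w₁ , w₂) (x₁ , x₂) = cong₂ _,_
    (solve 6 (λ u₁ u₂ w₁ w₂ x₁ x₂ → (u₁ :* w₂ :- u₂ :* w₁) :* x₁
                := (x₁ :* w₂ :- x₂ :* w₁) :* u₁ :+ (u₁ :* x₂ :- u₂ :* x₁) :* w₁)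
             refl u₁ u₂ w₁ w₂ x₁ x₂)
    (solve 6 (λ u₁ u₂ w₁ w₂ x₁ x₂ → (u₁ :* w₂ :- u₂ :* w₁) :* x₂
                := (x₁ :* w₂ :- x₂ :* w₁) :* u₂ :+ (u₁ :* x₂ :- u₂ :* x₁) :* w₂)
             refl u₁ u₂ w₁ w₂ x₁ x₂)

  ·-identityˡ : ∀ x → 1# · x ≡ x
  ·-identityˡ (x₁ , x₂) = cong₂ _,_ (*-identityˡ x₁) (*-identityˡ x₂)

  expand : ∀ {u w} → ω u w ≡ 1# → ∀ x → x ≡ ω x w · u ⊕ ω u x · w
  expand {u} {w} ω[u,w]≡1 x = begin
    x                     ≡⟨ sym (·-identityˡ x) ⟩
    1# · x                ≡⟨ cong (_· x) (sym ω[u,w]≡1) ⟩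
    ω u w · x             ≡⟨ cramer u w x ⟩
    ω x w · u ⊕ ω u x · w ∎

  act-transvection : ∀ θ u t x → act F θ (transvection u t x) ≡ act F θ x ⊕ (t * ω u x) · act F θ u
  act-transvection θ u t x = trans (act-⊕ θ x _) (cong (act F θ x ⊕_) (act-· θ _ u))

  transvection-0 : ∀ u x → transvection u 0# x ≡ x
  transvection-0 (u₁ , u₂) (x₁ , x₂) = cong₂ _,_ (lemma u₁ x₁) (lemma u₂ x₂)
    where
    lemma : ∀ uᵢ xᵢ → xᵢ + (0# * (u₁ * x₂ - u₂ * x₁)) * uᵢ ≡ xᵢ
    lemma uᵢ xᵢ = solve 6 (λ u₁ u₂ x₁ x₂ uᵢ xᵢ →
      xᵢ :+ (:0 :* (u₁ :* x₂ :- u₂ :* x₁)) :* uᵢ := xᵢ) refl u₁ u₂ x₁ x₂ uᵢ xᵢ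

  transvection-+ : ∀ u s t x → transvection u (s + t) x ≡ transvection u s (transvection u t x)
  transvection-+ (u₁ , u₂) s t (x₁ , x₂) = cong₂ _,_ (lemma u₁ x₁) (lemma u₂ x₂)
    where
    lemma : ∀ uᵢ xᵢ → xᵢ + ((s + t) * (u₁ * x₂ - u₂ * x₁)) * uᵢ
                    ≡ (xᵢ + (t * (u₁ * x₂ - u₂ * x₁)) * uᵢ)
                      + (s * (u₁ * (x₂ + (t * (u₁ * x₂ - u₂ * x₁)) * u₂)
                              - u₂ * (x₁ + (t * (u₁ * x₂ - u₂ * x₁)) * u₁))) * uᵢ
    lemma uᵢ xᵢ = solve 8 (λ u₁ u₂ x₁ x₂ s t uᵢ xᵢ →
      xᵢ :+ ((s :+ t) :* (u₁ :* x₂ :- u₂ :* x₁)) :* uᵢ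
        := (xᵢ :+ (t :* (u₁ :* x₂ :- u₂ :* x₁)) :* uᵢ)
           :+ (s :* (u₁ :* (x₂ :+ (t :* (u₁ :* x₂ :- u₂ :* x₁)) :* u₂)
                     :- u₂ :* (x₁ :+ (t :* (u₁ :* x₂ :- u₂ :* x₁)) :* u₁))) :* uᵢ)
      refl u₁ u₂ x₁ x₂ s t uᵢ xᵢ

  act-combination : ∀ θ α y β z → act F θ (α · y ⊕ β · z) ≡ α · act F θ y ⊕ β · act F θ z
  act-combination θ α y β z = trans (act-⊕ θ _ _) (cong₂ _⊕_ (act-· θ α y) (act-· θ β z))

  regroup : ∀ α β s a p → α · a ⊕ β · (s · a ⊕ 1# · p) ≡ (α · a ⊕ β · p) ⊕ (s * β) · a
  regroup α β s (a₁ , a₂) (p₁ , p₂) = cong₂ _,_ (lemma a₁ p₁) (lemma a₂ p₂)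
    where
    lemma : ∀ aᵢ pᵢ → α * aᵢ + β * (s * aᵢ + 1# * pᵢ) ≡ (α * aᵢ + β * pᵢ) + (s * β) * aᵢ
    lemma aᵢ pᵢ = solve 5 (λ α β s aᵢ pᵢ →
      α :* aᵢ :+ β :* (s :* aᵢ :+ :1 :* pᵢ) := (α :* aᵢ :+ β :* pᵢ) :+ (s :* β) :* aᵢ)
      refl α β s aᵢ pᵢ

  -- θ and θ₀ send u to a and w to vectors p, p₀ with ω a p = ω a p₀ = 1, so
  -- p - p₀ is a multiple of a; then expand x in the basis u, w.
  transvection-quotient : ∀ {θ θ₀ u w} → det F θ ≡ 1# → det F θ₀ ≡ 1# → ω u w ≡ 1# →
    act F θ u ≡ act F θ₀ u →
    ∀ x → act F θ x ≡ act F θ₀ (transvection u (ω (act F θ w) (act F θ₀ w)) x)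
  transvection-quotient {θ} {θ₀} {u} {w} detθ≡1 detθ₀≡1 ω[u,w]≡1 θu≡θ₀u x = begin
    act F θ x
      ≡⟨ cong (act F θ) (expand ω[u,w]≡1 x) ⟩
    act F θ (ω x w · u ⊕ ω u x · w)
      ≡⟨ act-combination θ _ u _ w ⟩
    ω x w · act F θ u ⊕ ω u x · p
      ≡⟨ cong₂ (λ b q → ω x w · b ⊕ ω u x · q) θu≡θ₀u p≡ ⟩
    ω x w · a ⊕ ω u x · (s · a ⊕ 1# · p₀)
      ≡⟨ regroup _ _ s a p₀ ⟩
    (ω x w · a ⊕ ω u x · p₀) ⊕ (s * ω u x) · a
      ≡⟨ cong (_⊕ (s * ω u x) · a) (sym (act-combination θ₀ _ u _ w)) ⟩
    act F θ₀ (ω x w · u ⊕ ω u x · w) ⊕ (s * ω u x) · a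
      ≡⟨ cong (λ y → act F θ₀ y ⊕ (s * ω u x) · a) (sym (expand ω[u,w]≡1 x)) ⟩
    act F θ₀ x ⊕ (s * ω u x) · a
      ≡⟨ sym (act-transvection θ₀ u s x) ⟩
    act F θ₀ (transvection u s x)
      ∎
    where
    a p p₀ : Point F
    a = act F θ₀ u
    p = act F θ w
    p₀ = act F θ₀ w
    s : Carrier
    s = ω p p₀
    unimodular : ∀ σ → det F σ ≡ 1# → ω (act F σ u) (act F σ w) ≡ 1#
    unimodular σ detσ≡1 = begin
      ω (act F σ u) (act F σ w) ≡⟨ ω-act σ u w ⟩
      det F σ * ω u w           ≡⟨ cong₂ _*_ detσ≡1 ω[u,w]≡1 ⟩
      1# * 1#                   ≡⟨ *-identityˡ 1# ⟩
      1#                        ∎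
    p≡ : p ≡ s · a ⊕ 1# · p₀
    p≡ = begin
      p                       ≡⟨ expand (unimodular θ₀ detθ₀≡1) p ⟩
      s · a ⊕ ω a p · p₀      ≡⟨ cong (λ b → s · a ⊕ ω b p · p₀) (sym θu≡θ₀u) ⟩
      s · a ⊕ ω (act F θ u) p · p₀ ≡⟨ cong (λ c → s · a ⊕ c · p₀) (unimodular θ detθ≡1) ⟩
      s · a ⊕ 1# · p₀         ∎

  adjugate : Mat F → Mat F
  adjugate (a , b , c , d) = (d , - b , - c , a)

  act-adjugate : ∀ θ x → act F (adjugate θ) (act F θ x) ≡ det F θ · x
  act-adjugate (a , b , c , d) (x₁ , x₂) = cong₂ _,_
    (solve 6 (λ a b c d x₁ x₂ → d :* (a :* x₁ :+ b :* x₂) :+ (:- b) :* (c :* x₁ :+ d :* x₂)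
                := (a :* d :- b :* c) :* x₁) refl a b c d x₁ x₂)
    (solve 6 (λ a b c d x₁ x₂ → (:- c) :* (a :* x₁ :+ b :* x₂) :+ a :* (c :* x₁ :+ d :* x₂)
                := (a :* d :- b :* c) :* x₂) refl a b c d x₁ x₂)

  act-injective : ∀ {θ x y} → det F θ ≡ 1# → act F θ x ≡ act F θ y → x ≡ y
  act-injective {θ} {x} {y} detθ≡1 θx≡θy = begin
    x                                ≡⟨ sym (·-identityˡ x) ⟩
    1# · x                           ≡⟨ cong (_· x) (sym detθ≡1) ⟩
    det F θ · x                      ≡⟨ sym (act-adjugate θ x) ⟩
    act F (adjugate θ) (act F θ x)   ≡⟨ cong (act F (adjugate θ)) θx≡θy ⟩
    act F (adjugate θ) (act F θ y)   ≡⟨ act-adjugate θ y ⟩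
    det F θ · y                      ≡⟨ cong (_· y) detθ≡1 ⟩
    1# · y                           ≡⟨ ·-identityˡ y ⟩
    y                                ∎

  act-extensional : ∀ {θ θ′} → (∀ x → act F θ x ≡ act F θ′ x) → θ ≡ θ′
  act-extensional {a , b , c , d} {a′ , b′ , c′ , d′} θ≗θ′ = entries
    (trans (sym (first a b)) (trans (cong proj₁ (θ≗θ′ (1# , 0#))) (first a′ b′)))
    (trans (sym (second a b)) (trans (cong proj₁ (θ≗θ′ (0# , 1#))) (second a′ b′)))
    (trans (sym (first c d)) (trans (cong proj₂ (θ≗θ′ (1# , 0#))) (first c′ d′)))
    (trans (sym (second c d)) (trans (cong proj₂ (θ≗θ′ (0# , 1#))) (second c′ d′)))
    where
    first : ∀ a b → a * 1# + b * 0# ≡ a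
    first = solve 2 (λ a b → a :* :1 :+ b :* :0 := a) refl
    second : ∀ a b → a * 0# + b * 1# ≡ b
    second = solve 2 (λ a b → a :* :0 :+ b :* :1 := b) refl
    entries : a ≡ a′ → b ≡ b′ → c ≡ c′ → d ≡ d′ → (a , b , c , d) ≡ (a′ , b′ , c′ , d′)
    entries refl refl refl refl = refl

  unimodular-partner : DecidableEquality Carrier → ∀ {u} → u ≢ origin F → ∃ λ w → ω u w ≡ 1#
  unimodular-partner _≟_ {u₁ , u₂} u≢0 with u₁ ≟ 0# | u₂ ≟ 0#
  ... | no u₁≢0 | _ = let (i , u₁i≡1) = inverse u₁ u₁≢0 in
    (0# , i) , trans (solve 3 (λ u₁ u₂ i → u₁ :* i :- u₂ :* :0 := u₁ :* i) refl u₁ u₂ i) u₁i≡1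
  ... | yes u₁≡0 | no u₂≢0 = let (i , u₂i≡1) = inverse u₂ u₂≢0 in
    (- i , 0#) , trans (solve 3 (λ u₁ u₂ i → u₁ :* :0 :- u₂ :* (:- i) := u₂ :* i) refl u₁ u₂ i) u₂i≡1
  ... | yes u₁≡0 | yes u₂≡0 = contradiction (cong₂ _,_ u₁≡0 u₂≡0) u≢0

  ω≡0⇒onLine : ∀ {u w v} → ω u w ≡ 1# → ω u v ≡ 0# → OnLineThrough F u v
  ω≡0⇒onLine {u} {w} {v} ω[u,w]≡1 ω[u,v]≡0 = ω v w , (begin
    v                          ≡⟨ expand ω[u,w]≡1 v ⟩
    ω v w · u ⊕ ω u v · w      ≡⟨ cong (λ c → ω v w · u ⊕ c · w) ω[u,v]≡0 ⟩
    ω v w · u ⊕ 0# · w         ≡⟨ ⊕-0· (ω v w · u) w ⟩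
    ω v w · u                  ∎)
    where
    ⊕-0· : ∀ x y → x ⊕ 0# · y ≡ x
    ⊕-0· (x₁ , x₂) (y₁ , y₂) = cong₂ _,_ (lemma x₁ y₁) (lemma x₂ y₂)
      where
      lemma : ∀ x y → x + 0# * y ≡ x
      lemma = solve 2 (λ x y → x :+ :0 :* y := x) refl

  transvection-along-first : ∀ u v t α β →
    transvection u t (α · u ⊕ β · v) ≡ (α + t * (β * ω u v)) · u ⊕ β · v
  transvection-along-first (u₁ , u₂) (v₁ , v₂) t α β = cong₂ _,_ (lemma u₁ v₁) (lemma u₂ v₂)
    where
    lemma : ∀ uᵢ vᵢ →
      (α * uᵢ + β * vᵢ) + (t * (u₁ * (α * u₂ + β * v₂) - u₂ * (α * u₁ + β * v₁))) * uᵢ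
        ≡ (α + t * (β * (u₁ * v₂ - u₂ * v₁))) * uᵢ + β * vᵢ
    lemma uᵢ vᵢ = solve 9 (λ u₁ u₂ v₁ v₂ t α β uᵢ vᵢ →
      (α :* uᵢ :+ β :* vᵢ) :+ (t :* (u₁ :* (α :* u₂ :+ β :* v₂) :- u₂ :* (α :* u₁ :+ β :* v₁))) :* uᵢ
        := (α :+ t :* (β :* (u₁ :* v₂ :- u₂ :* v₁))) :* uᵢ :+ β :* vᵢ)
      refl u₁ u₂ v₁ v₂ t α β uᵢ vᵢ

  transvection-along-second : ∀ u v t α β →
    transvection v (- t) (α · u ⊕ β · v) ≡ α · u ⊕ (β + t * (α * ω u v)) · v
  transvection-along-second (u₁ , u₂) (v₁ , v₂) t α β = cong₂ _,_ (lemma u₁ v₁) (lemma u₂ v₂)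
    where
    lemma : ∀ uᵢ vᵢ →
      (α * uᵢ + β * vᵢ) + (- t * (v₁ * (α * u₂ + β * v₂) - v₂ * (α * u₁ + β * v₁))) * vᵢ
        ≡ α * uᵢ + (β + t * (α * (u₁ * v₂ - u₂ * v₁))) * vᵢ
    lemma uᵢ vᵢ = solve 9 (λ u₁ u₂ v₁ v₂ t α β uᵢ vᵢ →
      (α :* uᵢ :+ β :* vᵢ) :+ (:- t :* (v₁ :* (α :* u₂ :+ β :* v₂) :- v₂ :* (α :* u₁ :+ β :* v₁))) :* vᵢ
        := α :* uᵢ :+ (β :+ t :* (α :* (u₁ :* v₂ :- u₂ :* v₁))) :* vᵢ)
      refl u₁ u₂ v₁ v₂ t α β uᵢ vᵢ

  inverse-cancelʳ : ∀ {a a⁻¹} → a * a⁻¹ ≡ 1# → ∀ x → (x * a⁻¹) * a ≡ x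
  inverse-cancelʳ {a} {a⁻¹} aa⁻¹≡1 x = begin
    (x * a⁻¹) * a   ≡⟨ solve 3 (λ x a a⁻¹ → (x :* a⁻¹) :* a := x :* (a :* a⁻¹)) refl x a a⁻¹ ⟩
    x * (a * a⁻¹)   ≡⟨ cong (x *_) aa⁻¹≡1 ⟩
    x * 1#          ≡⟨ *-identityʳ x ⟩
    x               ∎

  coordinates : ∀ {u v k} → ω u v * k ≡ 1# → ∀ y → y ≡ (ω y v * k) · u ⊕ (ω u y * k) · v
  coordinates {u} {v} {k} ω[u,v]k≡1 y = begin
    y                                     ≡⟨ sym (·-identityˡ y) ⟩
    1# · y                                ≡⟨ cong (_· y) (sym ω[u,v]k≡1) ⟩
    (ω u v * k) · y                       ≡⟨ ·-assoc (ω u v) k y ⟩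
    k · ω u v · y                         ≡⟨ cong (k ·_) (cramer u v y) ⟩
    k · (ω y v · u ⊕ ω u y · v)           ≡⟨ ·-distrib (ω y v) u (ω u y) v k ⟩
    (ω y v * k) · u ⊕ (ω u y * k) · v     ∎
    where
    ·-assoc : ∀ c k x → (c * k) · x ≡ k · c · x
    ·-assoc c k (x₁ , x₂) = cong₂ _,_ (lemma x₁) (lemma x₂)
      where
      lemma : ∀ xᵢ → (c * k) * xᵢ ≡ k * (c * xᵢ)
      lemma xᵢ = solve 3 (λ c k xᵢ → (c :* k) :* xᵢ := k :* (c :* xᵢ)) refl c k xᵢ
    ·-distrib : ∀ α u β v k → k · (α · u ⊕ β · v) ≡ (α * k) · u ⊕ (β * k) · v
    ·-distrib α (u₁ , u₂) β (v₁ , v₂) k = cong₂ _,_ (lemma u₁ v₁) (lemma u₂ v₂)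
      where
      lemma : ∀ uᵢ vᵢ → k * (α * uᵢ + β * vᵢ) ≡ (α * k) * uᵢ + (β * k) * vᵢ
      lemma uᵢ vᵢ = solve 5 (λ α β k uᵢ vᵢ →
        k :* (α :* uᵢ :+ β :* vᵢ) := (α :* k) :* uᵢ :+ (β :* k) :* vᵢ) refl α β k uᵢ vᵢ

  -- Transvections along independent u, v generate SL₂, which is transitive on
  -- nonzero vectors.  Explicitly, they shear the coordinates (α , β) in the
  -- basis u, v, and shears lead from (0 , 1) to every nonzero pair.
  module _ (_≟_ : DecidableEquality Carrier) (E : Point F → Set) {u v : Point F}
           (ω[u,v]≢0 : ω u v ≢ 0#) (Ev : E v)
           (closed-u : ∀ t {x} → E x → E (transvection u t x))
           (closed-v : ∀ t {x} → E x → E (transvection v t x)) where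

    private
      c c⁻¹ : Carrier
      c = ω u v
      c⁻¹ = proj₁ (inverse c ω[u,v]≢0)
      cc⁻¹≡1 : c * c⁻¹ ≡ 1#
      cc⁻¹≡1 = proj₂ (inverse c ω[u,v]≢0)

      P : Carrier → Carrier → Set
      P α β = E (α · u ⊕ β · v)

      P-resp : ∀ {α α′ β β′} → α ≡ α′ → β ≡ β′ → P α β → P α′ β′
      P-resp refl refl Pαβ = Pαβ

      cancel : ∀ x y → (x * c⁻¹) * (y * c) ≡ x * y
      cancel x y = trans
        (solve 4 (λ x y c c⁻¹ → (x :* c⁻¹) :* (y :* c) := ((x :* y) :* c⁻¹) :* c) refl x y c c⁻¹)
        (inverse-cancelʳ cc⁻¹≡1 (x * y))

      shear-u : ∀ s {α β} → P α β → P (α + s * β) β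
      shear-u s {α} {β} Pαβ = P-resp (cong (α +_) (cancel s β)) refl
        (subst E (transvection-along-first u v (s * c⁻¹) α β) (closed-u (s * c⁻¹) Pαβ))

      shear-v : ∀ s {α β} → P α β → P α (β + s * α)
      shear-v s {α} {β} Pαβ = P-resp refl (cong (β +_) (cancel s α))
        (subst E (transvection-along-second u v (s * c⁻¹) α β) (closed-v (- (s * c⁻¹)) Pαβ))

      0·⊕1· : ∀ x y → 0# · x ⊕ 1# · y ≡ y
      0·⊕1· (x₁ , x₂) (y₁ , y₂) = cong₂ _,_ (lemma x₁ y₁) (lemma x₂ y₂)
        where
        lemma : ∀ x y → 0# * x + 1# * y ≡ y
        lemma = solve 2 (λ x y → :0 :* x :+ :1 :* y := y) refl

      P[0,1] : P 0# 1#
      P[0,1] = subst E (sym (0·⊕1· u v)) Ev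

      P[α,1] : ∀ α → P α 1#
      P[α,1] α = P-resp (solve 1 (λ α → :0 :+ α :* :1 := α) refl α) refl (shear-u α P[0,1])

      P[α≢0,β] : ∀ {α} β → α ≢ 0# → P α β
      P[α≢0,β] {α} β α≢0 = P-resp refl β≡ (shear-v ((β - 1#) * α⁻¹) (P[α,1] α))
        where
        α⁻¹ : Carrier
        α⁻¹ = proj₁ (inverse α α≢0)
        β≡ : 1# + ((β - 1#) * α⁻¹) * α ≡ β
        β≡ = trans (cong (1# +_) (inverse-cancelʳ (proj₂ (inverse α α≢0)) (β - 1#)))
                   (solve 1 (λ β → :1 :+ (β :- :1) := β) refl β)

      P[0,β≢0] : ∀ {β} → β ≢ 0# → P 0# β
      P[0,β≢0] {β} β≢0 = P-resp 0≡ refl (shear-u (- 1# * β⁻¹) (P[α≢0,β] β (λ 1≡0 → 0≢1 (sym 1≡0))))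
        where
        β⁻¹ : Carrier
        β⁻¹ = proj₁ (inverse β β≢0)
        0≡ : 1# + ((- 1# * β⁻¹) * β) ≡ 0#
        0≡ = trans (cong (1# +_) (inverse-cancelʳ (proj₂ (inverse β β≢0)) (- 1#))) (-‿inverseʳ 1#)

      0·⊕0· : ∀ x y → 0# · x ⊕ 0# · y ≡ origin F
      0·⊕0· (x₁ , x₂) (y₁ , y₂) = cong₂ _,_ (lemma x₁ y₁) (lemma x₂ y₂)
        where
        lemma : ∀ x y → 0# * x + 0# * y ≡ 0#
        lemma = solve 2 (λ x y → :0 :* x :+ :0 :* y := :0) refl

    transvection-invariant⇒nonzero⊆ : ∀ y → y ≢ origin F → E y
    transvection-invariant⇒nonzero⊆ y y≢0 with (ω y v * c⁻¹) ≟ 0# | (ω u y * c⁻¹) ≟ 0#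
    ... | no α≢0  | _       = subst E (sym (coordinates cc⁻¹≡1 y)) (P[α≢0,β] _ α≢0)
    ... | yes α≡0 | no β≢0  = subst E (sym (coordinates cc⁻¹≡1 y)) (P-resp (sym α≡0) refl (P[0,β≢0] β≢0))
    ... | yes α≡0 | yes β≡0 = contradiction
      (trans (coordinates cc⁻¹≡1 y) (trans (cong₂ (λ α β → α · u ⊕ β · v) α≡0 β≡0) (0·⊕0· u v)))
      y≢0

module Symmetries (F : Field) (_≟_ : DecidableEquality (Field.Carrier F))
  (elements : List (Field.Carrier F)) (elements! : Unique elements) (∈-elements : ∀ x → x ∈ elements)
  (E : Point F → Set) (Es : List (Point F)) (E⇔Es : ∀ v → E v ⇔ v ∈ Es) where

  open import Data.List.Properties using (filter-notAll)
  open import Data.Nat.Divisibility using (_∣_; ∣⇒≤)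
  open import Data.Nat.Primality using (prime⇒nonZero)
  open import Data.Product.Properties using (≡-dec)
  open import Relation.Nullary using (_×-dec_)

  open Field F
  open Plane F
  open IntegerCoefficients F using (commutativeRing)
  open CommutativeRing commutativeRing using (+-isGroup; -‿inverseʳ)
  open import Algebra.Properties.AbelianGroup (CommutativeRing.+-abelianGroup commutativeRing) using (⁻¹-∙-comm)
  open import Algebra.Properties.Group (CommutativeRing.+-group commutativeRing) using (⁻¹-involutive; ε⁻¹≈ε)

  _≟ₚ_ : DecidableEquality (Point F)
  _≟ₚ_ = ≡-dec _≟_ _≟_

  open import Data.List.Membership.DecPropositional _≟ₚ_ using (_∈?_)

  toEs : ∀ {x} → E x → x ∈ Es
  toEs {x} = Equivalence.to (E⇔Es x)

  fromEs : ∀ {x} → x ∈ Es → E x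
  fromEs {x} = Equivalence.from (E⇔Es x)

  maps-into : ∀ {θ x} → InR F E θ → E x → E (act F θ x)
  maps-into {θ} {x} (_ , θE≡E) Ex = Equivalence.from (θE≡E (act F θ x)) (x , Ex , refl)

  reflects : ∀ {θ x} → InR F E θ → E (act F θ x) → E x
  reflects {θ} {x} (detθ≡1 , θE≡E) Eθx with Equivalence.to (θE≡E (act F θ x)) Eθx
  ... | y , Ey , θy≡θx = subst E (act-injective detθ≡1 θy≡θx) Ey

  -- Both t and - t are required so that the parameters t form a subgroup of (F , +).
  Stable : Point F → Carrier → Set
  Stable u t = All (λ x → transvection u t x ∈ Es × transvection u (- t) x ∈ Es) Es

  Stable? : ∀ u → Decidable (Stable u)
  Stable? u t = All.all? (λ x → (transvection u t x ∈? Es) ×-dec (transvection u (- t) x ∈? Es)) Es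

  Stable⇒closed : ∀ {u t x} → Stable u t → E x → E (transvection u t x)
  Stable⇒closed St Ex = fromEs (proj₁ (All.lookup St (toEs Ex)))

  Stable-0 : ∀ u → Stable u 0#
  Stable-0 u = All.tabulate λ {x} x∈Es →
    subst (_∈ Es) (sym (transvection-0 u x)) x∈Es ,
    subst (_∈ Es) (sym (trans (cong (λ t → transvection u t x) ε⁻¹≈ε) (transvection-0 u x))) x∈Es

  Stable-+ : ∀ {u s t} → Stable u s → Stable u t → Stable u (s + t)
  Stable-+ {u} {s} {t} Ss St = All.tabulate λ {x} x∈Es →
    subst (_∈ Es) (sym (transvection-+ u s t x)) (proj₁ (All.lookup Ss (proj₁ (All.lookup St x∈Es)))) ,
    subst (_∈ Es) (sym (trans (cong (λ r → transvection u r x) (sym (⁻¹-∙-comm s t)))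
                              (transvection-+ u (- s) (- t) x)))
      (proj₂ (All.lookup Ss (proj₂ (All.lookup St x∈Es))))

  Stable-neg : ∀ {u t} → Stable u t → Stable u (- t)
  Stable-neg {u} {t} St = All.tabulate λ {x} x∈Es →
    proj₂ (All.lookup St x∈Es) ,
    subst (λ r → transvection u r x ∈ Es) (sym (⁻¹-involutive t)) (proj₁ (All.lookup St x∈Es))

  |Stable| : Point F → ℕ
  |Stable| u = length (filter (Stable? u) elements)

  |Stable|∣|F| : ∀ u → |Stable| u ∣ length elements
  |Stable|∣|F| u =
    Lagrange.lagrange +-isGroup elements elements! ∈-elements (Stable? u) (Stable-0 u) Stable-+ Stable-neg

  fibre-bound : ∀ {u w} → ω u w ≡ 1# → ∀ a {zs} → Unique zs → All (InR F E) zs →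
                All (λ θ → act F θ u ≡ a) zs → length zs ≤ |Stable| u
  fibre-bound ω[u,w]≡1 a {[]}     _   _  _ = z≤n
  fibre-bound {u} {w} ω[u,w]≡1 a {θ₀ ∷ zs} zs! Rzs θu≡a =
    injection⇒length≤ parameter zs! (λ θ∈ → ∈-filter⁺ (Stable? u) (∈-elements _) (stable θ∈)) injective
    where
    parameter : Mat F → Carrier
    parameter θ = ω (act F θ w) (act F θ₀ w)
    R₀ : InR F E θ₀
    R₀ = All.lookup Rzs (here refl)
    factor : ∀ {θ} → θ ∈ θ₀ ∷ zs → ∀ x → act F θ x ≡ act F θ₀ (transvection u (parameter θ) x)
    factor θ∈ = transvection-quotient (proj₁ (All.lookup Rzs θ∈)) (proj₁ R₀) ω[u,w]≡1
      (trans (All.lookup θu≡a θ∈) (sym (All.lookup θu≡a (here refl))))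
    stable : ∀ {θ} → θ ∈ θ₀ ∷ zs → Stable u (parameter θ)
    stable {θ} θ∈ = All.tabulate λ {x} x∈Es →
      toEs (reflects R₀ (subst E (factor θ∈ x) (maps-into Rθ (fromEs x∈Es)))) ,
      toEs (reflects Rθ (subst E (θ₀x≡ x) (maps-into R₀ (fromEs x∈Es))))
      where
      Rθ : InR F E θ
      Rθ = All.lookup Rzs θ∈
      s : Carrier
      s = parameter θ
      θ₀x≡ : ∀ x → act F θ₀ x ≡ act F θ (transvection u (- s) x)
      θ₀x≡ x = sym (begin
        act F θ (transvection u (- s) x)
          ≡⟨ factor θ∈ _ ⟩
        act F θ₀ (transvection u s (transvection u (- s) x))
          ≡⟨ cong (act F θ₀) (sym (transvection-+ u s (- s) x)) ⟩
        act F θ₀ (transvection u (s + - s) x)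
          ≡⟨ cong (λ r → act F θ₀ (transvection u r x)) (-‿inverseʳ s) ⟩
        act F θ₀ (transvection u 0# x)
          ≡⟨ cong (act F θ₀) (transvection-0 u x) ⟩
        act F θ₀ x
          ∎)
        where open ≡-Reasoning
    injective : ∀ {θ θ′} → θ ∈ θ₀ ∷ zs → θ′ ∈ θ₀ ∷ zs →
                parameter θ ≡ parameter θ′ → θ ≡ θ′
    injective θ∈ θ′∈ s≡s′ = act-extensional λ x →
      trans (factor θ∈ x) (trans (cong (λ s → act F θ₀ (transvection u s x)) s≡s′) (sym (factor θ′∈ x)))

  symmetries≤|E|*|Stable| : ∀ {u w} → E u → ω u w ≡ 1# → ∀ {Rs} → Unique Rs → All (InR F E) Rs →
                             length Rs ≤ length Es ℕ.* |Stable| u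
  symmetries≤|E|*|Stable| {u} Eu ω[u,w]≡1 Rs! R =
    fibre-bound⇒length≤ (λ θ → act F θ u) _≟ₚ_ (|Stable| u) (fibre-bound ω[u,w]≡1)
      Es Rs! R (All.map (λ Rθ → toEs (maps-into Rθ Eu)) R)

  |Stable|≤p^r : ∀ {p u} r → Prime p → length elements ≡ p ^ suc r → ¬ All (Stable u) elements →
                 |Stable| u ≤ p ^ r
  |Stable|≤p^r {p} {u} r p-prime |F|≡p^[1+r] ¬all =
    ∣⇒≤ {{ℕ.m^n≢0 p r}}
      (proper∣p^[1+r]⇒∣p^r r p-prime (subst (|Stable| u ∣_) |F|≡p^[1+r] (|Stable|∣|F| u))
        (λ |S|≡p^[1+r] → ℕ.<⇒≢ proper (trans |S|≡p^[1+r] (sym |F|≡p^[1+r]))))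
    where
    instance _ = prime⇒nonZero p-prime
    proper : |Stable| u < length elements
    proper = filter-notAll (Stable? u) elements (All.¬All⇒Any¬ (Stable? u) elements ¬all)

  symmetries≤p^r*|E| : ∀ {p u} r → Prime p → length elements ≡ p ^ suc r → E u → u ≢ origin F →
    ¬ All (Stable u) elements → ∀ {Rs} → Unique Rs → All (InR F E) Rs → length Rs ≤ p ^ r ℕ.* length Es
  symmetries≤p^r*|E| {p} {u} r p-prime |F|≡p^[1+r] Eu u≢0 ¬all {Rs} Rs! R = begin
    length Rs                  ≤⟨ symmetries≤|E|*|Stable| Eu (proj₂ (unimodular-partner _≟_ u≢0)) Rs! R ⟩
    length Es ℕ.* |Stable| u   ≤⟨ ℕ.*-monoʳ-≤ (length Es) (|Stable|≤p^r r p-prime |F|≡p^[1+r] ¬all) ⟩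
    length Es ℕ.* p ^ r        ≡⟨ ℕ.*-comm (length Es) (p ^ r) ⟩
    p ^ r ℕ.* length Es        ∎
    where open ℕ.≤-Reasoning

  all-stable⇒nonzero⊆E : ∀ {u v} → E v → u ≢ origin F → ¬ OnLineThrough F u v →
    All (Stable u) elements → All (Stable v) elements → ∀ y → y ≢ origin F → E y
  all-stable⇒nonzero⊆E {u} {v} Ev u≢0 ¬u∥v all-u all-v =
    transvection-invariant⇒nonzero⊆ _≟_ E ω[u,v]≢0 Ev
      (λ t → Stable⇒closed (All.lookup all-u (∈-elements t)))
      (λ t → Stable⇒closed (All.lookup all-v (∈-elements t)))
    where
    ω[u,v]≢0 : ω u v ≢ 0#
    ω[u,v]≢0 ω[u,v]≡0 = ¬u∥v (ω≡0⇒onLine (proj₂ (unimodular-partner _≟_ u≢0)) ω[u,v]≡0)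

  nonzero⊆E⇒ : (∀ y → y ≢ origin F → E y) → (∀ y → E y) ⊎ (∀ y → E y ⇔ y ≢ origin F)
  nonzero⊆E⇒ nonzero⊆E with origin F ∈? Es
  ... | yes 0∈Es = inj₁ everywhere
    where
    everywhere : ∀ y → E y
    everywhere y with y ≟ₚ origin F
    ... | yes refl = fromEs 0∈Es
    ... | no y≢0   = nonzero⊆E y y≢0
  ... | no 0∉Es = inj₂ λ y → mk⇔ (λ Ey y≡0 → 0∉Es (toEs (subst E y≡0 Ey))) (nonzero⊆E y)

module _ {n} {A : Set} (Fin↔A : Fin n ↔ A) where

  open import Data.Fin as Fin using ()
  open import Data.List.Properties using (length-map; length-tabulate)
  open import Function using (id)
  open import Function.Bundles using (Inverse; Injection)
  open import Function.Properties.Inverse using (↔⇒↣; ↔-sym)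
  open import Relation.Nullary.Decidable using (via-injection)

  open Inverse Fin↔A using (to; from; strictlyInverseˡ)

  enumeration : List A
  enumeration = map to (allFin n)

  enumeration! : Unique enumeration
  enumeration! = Unique.map⁺ (Injection.injective (↔⇒↣ Fin↔A)) (Unique.allFin⁺ n)

  ∈-enumeration : ∀ x → x ∈ enumeration
  ∈-enumeration x = subst (_∈ enumeration) (strictlyInverseˡ x) (∈-map⁺ to (∈-allFin (from x)))

  length-enumeration : length enumeration ≡ n
  length-enumeration = trans (length-map to (allFin n)) (length-tabulate id)

  ↔Fin⇒≟ : DecidableEquality A
  ↔Fin⇒≟ = via-injection (↔⇒↣ (↔-sym Fin↔A)) Fin._≟_

-- ℕ's _*_ is opened only here: above it would clash with the field's.
open import Data.Nat using (_*_; _∸_)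

proposition1p11 :
    (F : Field) (p r q : ℕ) → Prime p → 1 ≤ r → q ≡ p ^ r →
    (Fin q ↔ Field.Carrier F) →
    (E : Point F → Set) →
    ¬ (∀ v → (E v ⇔ (v ≢ origin F))) →
    ¬ (∀ v → E v) →
    (∃ λ u → ∃ λ v → E u × E v × u ≢ origin F × v ≢ origin F
        × ¬ OnLineThrough F u v) →
    (Rs : List (Mat F)) → Unique Rs → All (InR F E) Rs →
    (Es : List (Point F)) → Unique Es → (∀ v → (E v ⇔ (v ∈ Es))) →
    length Rs ≤ p ^ (r ∸ 1) * length Es
proposition1p11 F p (suc r) _ p-prime (s≤s z≤n) refl Fin↔F E E≢F²∖0 E≢F²
  (u , v , Eu , Ev , u≢0 , v≢0 , ¬u∥v) Rs Rs! R Es _ E⇔Es =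
  by-stability (All.all? (Stable? u) elements) (All.all? (Stable? v) elements)
  where
  elements : List (Field.Carrier F)
  elements = enumeration Fin↔F
  open Symmetries F (↔Fin⇒≟ Fin↔F) elements (enumeration! Fin↔F) (∈-enumeration Fin↔F) E Es E⇔Es
  by-stability : Dec (All (Stable u) elements) → Dec (All (Stable v) elements) →
                 length Rs ≤ p ^ r * length Es
  by-stability (no ¬all-u) _ = symmetries≤p^r*|E| r p-prime (length-enumeration Fin↔F) Eu u≢0 ¬all-u Rs! R
  by-stability _ (no ¬all-v) = symmetries≤p^r*|E| r p-prime (length-enumeration Fin↔F) Ev v≢0 ¬all-v Rs! R
  by-stability (yes all-u) (yes all-v) =
    ⊥-elim ([ E≢F² , E≢F²∖0 ]′ (nonzero⊆E⇒ (all-stable⇒nonzero⊆E Ev u≢0 ¬u∥v all-u all-v)))
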